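{- The family $\mathcal{T}_n \subset 2^{\binom{[n]}{2}}$ of labelled spanning trees of $K_n$ (each identified with its edge set) is $(n/2, n-1)$-spread.
   Context: For $\mathcal{F} \subset 2^{[m]}$ and $X \subset [m]$, let $\mathcal{F}(X) := \{A \setminus X : A \in \mathcal{F}, X \subset A\}$. For $r>1$, a family $\mathcal{F} \subset 2^{[m]}$ is $r$-spread if $|\mathcal{F}(X)| \leq r^{ -|X|}|\mathcal{F}|$ for all $X \subset [m]$. A family $\mathcal{F}\subset 2^{[m]}$ is $(r,t)$-spread if for every $T \subset [m]$ with $|T| \leq t$ the family $\mathcal{F}(T)$ is $r$-spread; equivalently, for every $T \subset [m]$ with $|T|\le t$ and every $U$ with $T \subseteq U \subseteq [m]$, $|\mathcal{F}(U)| \leq r^{ -(|U|-|T|)}|\mathcal{F}(T)|$. Here $m=\binom{n}{2}$ with ground set $\binom{[n]}{2}$. -}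

module Defs where

open import Data.Nat using (ℕ; zero; suc; _+_; _*_; _∸_; _^_; _≤_; _<_)
open import Data.Fin using (Fin; zero; suc)
open import Data.Fin.Subset using (Subset; _⊆_; _∪_; _─_; ∣_∣)
open import Data.Bool using (Bool; true)
open import Data.List using (List; []; _∷_; [_]; _++_; length; map; allFin)
open import Data.List.Membership.Propositional using (_∈_)
open import Data.List.Relation.Unary.Unique.Propositional using (Unique)
open import Data.Vec using (Vec; lookup; fromList)
open import Data.Product using (Σ; _×_; _,_)
open import Data.Sum using (_⊎_)
open import Data.Unit using (⊤)
open import Relation.Nullary using (¬_)
open import Relation.Binary.PropositionalEquality using (_≡_)
open import Function.Bundles using (_⇔_)

Family : ℕ → Set₁
Family m = Subset m → Set

restrict : ∀ {m} → Family m → Subset m → Family m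
restrict {m} 𝓕 X B = Σ (Subset m) λ A → 𝓕 A × X ⊆ A × B ≡ A ─ X

-- Cardinality of a family: |𝓕| = k means there is a duplicate-free list of
-- exactly k subsets whose members are exactly the members of 𝓕.
HasSize : ∀ {m} → Family m → ℕ → Set
HasSize {m} 𝓕 k =
  Σ (List (Subset m)) λ L → length L ≡ k × Unique L × (∀ B → (B ∈ L) ⇔ 𝓕 B)

-- 𝓕 is r-spread with r = p / q (p, q natural, q > 0):
-- |𝓕(X)| ≤ r^{-|X|} |𝓕|  ⇔  p^|X| · |𝓕(X)| ≤ q^|X| · |𝓕|   for all X ⊆ [m].
-- (The paper additionally requires r > 1; that is imposed in the statement.)
Spread : ∀ {m} → ℕ → ℕ → Family m → Set
Spread p q 𝓕 = ∀ X k l → HasSize (restrict 𝓕 X) k → HasSize 𝓕 l →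
  p ^ ∣ X ∣ * k ≤ q ^ ∣ X ∣ * l

SpreadRT : ∀ {m} → ℕ → ℕ → ℕ → Family m → Set
SpreadRT {m} p q t 𝓕 = ∀ (T : Subset m) → ∣ T ∣ ≤ t → Spread p q (restrict 𝓕 T)

-- All pairs (i , j) with i < j, each unordered pair listed exactly once.
pairs : (n : ℕ) → List (Fin n × Fin n)
pairs zero = []
pairs (suc n) =
  map (λ j → (zero , suc j)) (allFin n) ++ map (λ e → (suc (Data.Product.proj₁ e) , suc (Data.Product.proj₂ e))) (pairs n)

numEdges : ℕ → ℕ
numEdges n = length (pairs n)

edge : (n : ℕ) → Fin (numEdges n) → Fin n × Fin n
edge n = lookup (fromList (pairs n))

module _ {n : ℕ} (S : Subset (numEdges n)) where

  Adj : Fin n → Fin n → Set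
  Adj u v = Σ (Fin (numEdges n)) λ e →
    lookup S e ≡ true × (edge n e ≡ (u , v) ⊎ edge n e ≡ (v , u))

  data Reach : Fin n → Fin n → Set where
    here : ∀ {u} → Reach u u
    step : ∀ {u v w} → Adj u v → Reach v w → Reach u w

  Connected : Set
  Connected = ∀ u v → Reach u v

  IsWalk : List (Fin n) → Set
  IsWalk [] = ⊤
  IsWalk (x ∷ []) = ⊤
  IsWalk (x ∷ y ∷ r) = Adj x y × IsWalk (y ∷ r)

  HasCycle : Set
  HasCycle = Σ (Fin n) λ v₀ → Σ (List (Fin n)) λ rest →
    2 ≤ length rest × Unique (v₀ ∷ rest) × IsWalk (v₀ ∷ rest ++ [ v₀ ])

  IsSpanningTree : Set
  IsSpanningTree = Connected × ¬ HasCycle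

SpanningTrees : (n : ℕ) → Family (numEdges n)
SpanningTrees n S = IsSpanningTree {n} S

module Submission where

-- Write 𝓕 = 𝒯ₙ(T) and c(Y) for the number of members of 𝓕 containing Y.  As B ↦ B ∪ X
-- injects 𝓕(X) into the members containing X, and X can be emptied one edge at a time, it
-- suffices that n · c(X) ≤ 2 · c(X − e) for e ∈ X.  Let e = pq.  For a member B ⊇ X and a
-- vertex v, the edge e is a bridge of the spanning tree B ∪ T, and v lies on the q-side or on
-- the p-side of it; replacing e by pv, respectively qv, gives another spanning tree containing
-- T ∪ (X − e).  The map (B, v) ↦ (new member, side) is injective: two different exchanges
-- producing the same tree would connect p and q in one of the two trees with e removed.

open import Defs
open import Data.Bool using (Bool; true; false)
import Data.Bool.Properties as Bool
open import Data.Empty using (⊥; ⊥-elim)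
open import Data.Fin as Fin using (Fin; zero; suc; _≟_)
open import Data.Fin.Properties using (<-cmp; any?)
open import Data.Fin.Subset
  using (Subset; inside; outside; _∈_; _∉_; _⊆_; _∪_; _─_; _-_; ⁅_⁆; ∣_∣)
open import Data.Fin.Subset.Properties
  using ( _∈?_; _⊆?_; ⊆-antisym; p⊆p∪q; q⊆p∪q; x∈p∪q⁺; x∈p∪q⁻; p─q⊆p
        ; x∈p∧x∉q⇒x∈p─q; x∈p∧x≢y⇒x∈p-y; p─⊥≡p; x∈⁅x⁆; x∈⁅y⁆⇒x≡y )
open import Data.List using (List; []; _∷_; [_]; _++_; length; map; allFin; filter; cartesianProduct)
import Data.List.Membership.Propositional as List
open import Data.List.Membership.Propositional.Properties
  using ( ∈-∃++; ∈-++⁻; ∈-++⁺ˡ; ∈-++⁺ʳ; ∈-map⁺; ∈-map⁻; ∈-allFin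
        ; ∈-filter⁺; ∈-filter⁻; ∈-cartesianProduct⁺; ∈-cartesianProduct⁻ )
open import Data.List.Properties using (length-++; length-map; length-tabulate; length-filter)
open import Data.List.Relation.Unary.Any as Any using (here; there)
open import Data.List.Relation.Unary.All as All using ([]; _∷_)
open import Data.List.Relation.Unary.All.Properties using (¬Any⇒All¬)
open import Data.List.Relation.Unary.AllPairs using ([]; _∷_)
open import Data.List.Relation.Unary.Unique.Propositional using (Unique)
import Data.List.Relation.Unary.Unique.Propositional.Properties as Unique
open import Data.Nat using (ℕ; zero; suc; _+_; _*_; _∸_; _^_; _≤_; _<_; z≤n; s≤s)
open import Data.Nat.Properties
  using ( ≤-trans; n≤1+n; <-asym; <-irrefl; +-suc; *-assoc; *-comm; *-monoʳ-≤; *-identityˡ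
        ; suc-injective; *-commutativeSemigroup; module ≤-Reasoning )
open import Level using (Level)
open import Algebra.Properties.CommutativeSemigroup *-commutativeSemigroup using (x∙yz≈y∙xz)
open import Data.Product using (Σ; ∃; _×_; _,_; proj₁; proj₂; map₂)
open import Data.Product.Properties using (≡-dec)
open import Data.Sum using (_⊎_; inj₁; inj₂)
open import Data.Vec as Vec using (_∷_; lookup; fromList)
open import Data.Vec.Properties using ([]=⇒lookup; lookup⇒[]=)
open import Function.Base using (case_of_)
open import Function.Bundles using (_⇔_; Equivalence)
open import Relation.Binary using (tri<; tri≈; tri>)
open import Relation.Binary.PropositionalEquality
  using (_≡_; _≢_; ≢-sym; refl; sym; trans; cong; cong₂; subst; subst₂; module ≡-Reasoning)
open import Relation.Nullary using (¬_; Dec; yes; no)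
open import Relation.Nullary.Decidable using (_×-dec_; _⊎-dec_)

private
  variable
    a b : Level
    A : Set a
    B : Set b

length-≤-injection : (f : A → B) {xs : List A} {ys : List B} → Unique xs →
  (∀ {x} → x List.∈ xs → f x List.∈ ys) →
  (∀ {x y} → x List.∈ xs → y List.∈ xs → f x ≡ f y → x ≡ y) →
  length xs ≤ length ys
length-≤-injection f {[]} _ _ _ = z≤n
length-≤-injection f {x ∷ xs} (x∉xs ∷ xs!) into inj with ∈-∃++ (into (here refl))
... | before , after , refl = begin
  suc (length xs)                      ≤⟨ s≤s (length-≤-injection f xs! into′ injective′) ⟩
  suc (length (before ++ after))       ≡⟨ cong suc (length-++ before) ⟩
  suc (length before + length after)   ≡⟨ +-suc (length before) (length after) ⟨
  length before + length (f x ∷ after) ≡⟨ length-++ before ⟨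
  length (before ++ f x ∷ after)       ∎
  where
  open ≤-Reasoning
  into′ : ∀ {y} → y List.∈ xs → f y List.∈ before ++ after
  into′ y∈xs with ∈-++⁻ before (into (there y∈xs))
  ... | inj₁ in-before        = ∈-++⁺ˡ in-before
  ... | inj₂ (here fy≡fx)     =
    ⊥-elim (All.lookup x∉xs y∈xs (sym (inj (there y∈xs) (here refl) fy≡fx)))
  ... | inj₂ (there in-after) = ∈-++⁺ʳ before in-after
  injective′ : ∀ {y z} → y List.∈ xs → z List.∈ xs → f y ≡ f z → y ≡ z
  injective′ y∈xs z∈xs = inj (there y∈xs) (there z∈xs)

unique⇒length≤ : ∀ {n} {xs : List (Fin n)} → Unique xs → length xs ≤ n
unique⇒length≤ {n} {xs} xs! = subst (length xs ≤_) (length-tabulate {n = n} (λ i → i))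
  (length-≤-injection (λ i → i) xs! (λ {i} _ → ∈-allFin i) (λ _ _ eq → eq))

length-cartesianProduct : (xs : List A) (ys : List B) →
  length (cartesianProduct xs ys) ≡ length xs * length ys
length-cartesianProduct []       ys = refl
length-cartesianProduct (x ∷ xs) ys = begin
  length (map (x ,_) ys ++ cartesianProduct xs ys)         ≡⟨ length-++ (map (x ,_) ys) ⟩
  length (map (x ,_) ys) + length (cartesianProduct xs ys) ≡⟨ cong₂ _+_ (length-map (x ,_) ys)
                                                                      (length-cartesianProduct xs ys) ⟩
  length ys + length xs * length ys                        ∎
  where
  open ≡-Reasoning

pairs-ordered : ∀ n {u v : Fin n} → (u , v) List.∈ pairs n → u Fin.< v
pairs-ordered (suc n) uv∈ with ∈-++⁻ (map (λ j → (zero , suc j)) (allFin n)) uv∈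
... | inj₁ from-zero with ∈-map⁻ (λ j → (zero , suc j)) from-zero
...   | _ , _ , refl = s≤s z≤n
pairs-ordered (suc n) uv∈ | inj₂ shifted with ∈-map⁻ _ shifted
...   | _ , uv∈′ , refl = s≤s (pairs-ordered n uv∈′)

pairs-complete : ∀ n {u v : Fin n} → u Fin.< v → (u , v) List.∈ pairs n
pairs-complete (suc n) {zero}  {suc v} _ = ∈-++⁺ˡ (∈-map⁺ (λ j → (zero , suc j)) (∈-allFin v))
pairs-complete (suc n) {suc u} {suc v} (s≤s u<v) =
  ∈-++⁺ʳ (map (λ j → (zero , suc j)) (allFin n)) (∈-map⁺ _ (pairs-complete n u<v))

pairs-unique : ∀ n → Unique (pairs n)
pairs-unique zero    = []
pairs-unique (suc n) =
  Unique.++⁺ (Unique.map⁺ (λ { refl → refl }) (Unique.allFin⁺ n))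
             (Unique.map⁺ (λ { refl → refl }) (pairs-unique n))
             disjoint
  where
  disjoint : ∀ {uv} → ¬ (uv List.∈ map (λ j → (zero , suc j)) (allFin n) × uv List.∈ map _ (pairs n))
  disjoint (from-zero , shifted) with ∈-map⁻ (λ j → (zero , suc j)) from-zero | ∈-map⁻ _ shifted
  ... | _ , _ , refl | _ , _ , ()

lookup-fromList-∈ : (xs : List A) (i : Fin (length xs)) → lookup (fromList xs) i List.∈ xs
lookup-fromList-∈ (x ∷ xs) zero    = here refl
lookup-fromList-∈ (x ∷ xs) (suc i) = there (lookup-fromList-∈ xs i)

lookup-fromList-surjective : ∀ {xs : List A} {x} → x List.∈ xs →
  ∃ λ i → lookup (fromList xs) i ≡ x
lookup-fromList-surjective (here refl) = zero , refl
lookup-fromList-surjective (there x∈xs) with lookup-fromList-surjective x∈xs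
... | i , eq = suc i , eq

lookup-fromList-injective : ∀ {xs : List A} → Unique xs → ∀ i j →
  lookup (fromList xs) i ≡ lookup (fromList xs) j → i ≡ j
lookup-fromList-injective {xs = _ ∷ _}  _          zero    zero    _  = refl
lookup-fromList-injective {xs = _ ∷ xs} (x∉xs ∷ _) zero    (suc j) eq =
  ⊥-elim (All.lookup x∉xs (lookup-fromList-∈ xs j) eq)
lookup-fromList-injective {xs = _ ∷ xs} (x∉xs ∷ _) (suc i) zero    eq =
  ⊥-elim (All.lookup x∉xs (lookup-fromList-∈ xs i) (sym eq))
lookup-fromList-injective {xs = _ ∷ _}  (_ ∷ xs!)  (suc i) (suc j) eq =
  cong suc (lookup-fromList-injective xs! i j eq)

edge-ordered : ∀ n (e : Fin (numEdges n)) → proj₁ (edge n e) Fin.< proj₂ (edge n e)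
edge-ordered n e = pairs-ordered n (lookup-fromList-∈ (pairs n) e)

edge-injective : ∀ n {e e′ : Fin (numEdges n)} → edge n e ≡ edge n e′ → e ≡ e′
edge-injective n = lookup-fromList-injective (pairs-unique n) _ _

edge-surjective : ∀ n {u v : Fin n} → u Fin.< v → ∃ λ e → edge n e ≡ (u , v)
edge-surjective n u<v = lookup-fromList-surjective (pairs-complete n u<v)

x∈p─q⇒x∉q : ∀ {m} {x : Fin m} (p q : Subset m) → x ∈ p ─ q → x ∉ q
x∈p─q⇒x∉q (inside ∷ _) (outside ∷ _) Vec.here ()
x∈p─q⇒x∉q (_ ∷ p) (_ ∷ q) (Vec.there x∈p─q) (Vec.there x∈q) =
  x∈p─q⇒x∉q p q x∈p─q x∈q

∣p∣≡1+s⇒∣p-x∣≡s : ∀ {m} (p : Subset m) {s} → ∣ p ∣ ≡ suc s →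
  ∃ λ x → x ∈ p × ∣ p - x ∣ ≡ s
∣p∣≡1+s⇒∣p-x∣≡s (inside ∷ p) eq =
  zero , Vec.here , trans (cong ∣_∣ (p─⊥≡p p)) (suc-injective eq)
∣p∣≡1+s⇒∣p-x∣≡s (outside ∷ p) eq with ∣p∣≡1+s⇒∣p-x∣≡s p eq
... | x , x∈p , eq′ = suc x , Vec.there x∈p , eq′

module _ {m : ℕ} where

  Disjoint : Subset m → Subset m → Set
  Disjoint p q = ∀ {x} → x ∈ p → x ∉ q

  x∈p-y⇒x≢y : ∀ {x y} {p : Subset m} → x ∈ p - y → x ≢ y
  x∈p-y⇒x≢y {y = y} {p} x∈ refl = x∈p─q⇒x∉q p ⁅ y ⁆ x∈ (x∈⁅x⁆ y)

  p-x⊆p : ∀ {p : Subset m} {x} → p - x ⊆ p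
  p-x⊆p {p} {x} = p─q⊆p p ⁅ x ⁆

  p⊆q⇒p-x⊆q-x : ∀ {p q : Subset m} {x} → p ⊆ q → p - x ⊆ q - x
  p⊆q⇒p-x⊆q-x p⊆q y∈ = x∈p∧x≢y⇒x∈p-y (p⊆q (p-x⊆p y∈)) (x∈p-y⇒x≢y y∈)

  p─q∪q≡p : ∀ {p q : Subset m} → q ⊆ p → (p ─ q) ∪ q ≡ p
  p─q∪q≡p {p} {q} q⊆p = ⊆-antisym ⊆p p⊆
    where
    ⊆p : (p ─ q) ∪ q ⊆ p
    ⊆p x∈ with x∈p∪q⁻ (p ─ q) q x∈
    ... | inj₁ x∈p─q = p─q⊆p p q x∈p─q
    ... | inj₂ x∈q   = q⊆p x∈q
    p⊆ : p ⊆ (p ─ q) ∪ q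
    p⊆ {x} x∈p with x ∈? q
    ... | yes x∈q = x∈p∪q⁺ (inj₂ x∈q)
    ... | no  x∉q = x∈p∪q⁺ (inj₁ (x∈p∧x∉q⇒x∈p─q x∈p x∉q))

  p∪q─q≡p : ∀ {p q : Subset m} → Disjoint p q → (p ∪ q) ─ q ≡ p
  p∪q─q≡p {p} {q} p#q = ⊆-antisym ⊆p p⊆
    where
    ⊆p : (p ∪ q) ─ q ⊆ p
    ⊆p x∈ with x∈p∪q⁻ p q (p─q⊆p (p ∪ q) q x∈)
    ... | inj₁ x∈p = x∈p
    ... | inj₂ x∈q = ⊥-elim (x∈p─q⇒x∉q (p ∪ q) q x∈ x∈q)
    p⊆ : p ⊆ (p ∪ q) ─ q
    p⊆ x∈p = x∈p∧x∉q⇒x∈p─q (x∈p∪q⁺ (inj₁ x∈p)) (p#q x∈p)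

  exchange : Subset m → Fin m → Fin m → Subset m
  exchange p x y = (p - x) ∪ ⁅ y ⁆

  ∈-exchange⁺ : ∀ {p : Subset m} {x y z} → z ∈ p → z ≢ x → z ∈ exchange p x y
  ∈-exchange⁺ z∈p z≢x = p⊆p∪q _ (x∈p∧x≢y⇒x∈p-y z∈p z≢x)

  y∈exchange : ∀ {p : Subset m} {x} y → y ∈ exchange p x y
  y∈exchange {p} {x} y = q⊆p∪q (p - x) ⁅ y ⁆ (x∈⁅x⁆ y)

  ∈-exchange⁻ : ∀ {p : Subset m} {x y z} → z ∈ exchange p x y → z ≢ y → z ∈ p - x
  ∈-exchange⁻ {p} {x} {y} z∈ z≢y with x∈p∪q⁻ (p - x) ⁅ y ⁆ z∈
  ... | inj₁ z∈p-x = z∈p-x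
  ... | inj₂ z∈⁅y⁆ = ⊥-elim (z≢y (x∈⁅y⁆⇒x≡y y z∈⁅y⁆))

  exchange-cancel : ∀ {p : Subset m} {x y} → x ∈ p → (y ∈ p → y ≡ x) →
    exchange (exchange p x y) y x ≡ p
  exchange-cancel {p} {x} {y} x∈p y∈p⇒y≡x = ⊆-antisym ⊆p p⊆
    where
    ⊆p : exchange (exchange p x y) y x ⊆ p
    ⊆p z∈ with x∈p∪q⁻ (exchange p x y - y) ⁅ x ⁆ z∈
    ... | inj₁ z∈′ = p-x⊆p (∈-exchange⁻ (p-x⊆p z∈′) (x∈p-y⇒x≢y z∈′))
    ... | inj₂ z∈⁅x⁆ rewrite x∈⁅y⁆⇒x≡y x z∈⁅x⁆ = x∈p
    p⊆ : p ⊆ exchange (exchange p x y) y x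
    p⊆ {z} z∈p with z ≟ x
    ... | yes refl = y∈exchange z
    ... | no  z≢x  = ∈-exchange⁺ (∈-exchange⁺ z∈p z≢x) λ { refl → z≢x (y∈p⇒y≡x z∈p) }

supersets : ∀ {m} → Subset m → List (Subset m) → List (Subset m)
supersets X = filter (X ⊆?_)

restrict⇒∪ : ∀ {m} {𝓕 : Family m} {X B} → restrict 𝓕 X B → 𝓕 (B ∪ X) × Disjoint B X
restrict⇒∪ {𝓕 = 𝓕} {X} (A , A∈𝓕 , X⊆A , refl) =
  subst 𝓕 (sym (p─q∪q≡p X⊆A)) A∈𝓕 , x∈p─q⇒x∉q A X

∣restrict∣≤∣supersets∣ : ∀ {m} {𝓕 : Family m} {X} {K L : List (Subset m)} → Unique K →
  (∀ {B} → B List.∈ K → restrict 𝓕 X B) → (∀ {A} → 𝓕 A → A List.∈ L) →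
  length K ≤ length (supersets X L)
∣restrict∣≤∣supersets∣ {X = X} {K} {L} K! K⊆𝓕X 𝓕⊆L =
  length-≤-injection (_∪ X) K! into injective
  where
  into : ∀ {B} → B List.∈ K → B ∪ X List.∈ supersets X L
  into {B} B∈K = ∈-filter⁺ (X ⊆?_) (𝓕⊆L (proj₁ (restrict⇒∪ (K⊆𝓕X B∈K)))) (q⊆p∪q B X)
  injective : ∀ {B₁ B₂} → B₁ List.∈ K → B₂ List.∈ K → B₁ ∪ X ≡ B₂ ∪ X → B₁ ≡ B₂
  injective {B₁} {B₂} B₁∈K B₂∈K eq = begin
    B₁           ≡⟨ p∪q─q≡p (proj₂ (restrict⇒∪ (K⊆𝓕X B₁∈K))) ⟨
    (B₁ ∪ X) ─ X ≡⟨ cong (_─ X) eq ⟩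
    (B₂ ∪ X) ─ X ≡⟨ p∪q─q≡p (proj₂ (restrict⇒∪ (K⊆𝓕X B₂∈K))) ⟩
    B₂           ∎
    where open ≡-Reasoning

supersets-spread : ∀ {m} (a b : ℕ) (L : List (Subset m)) →
  (∀ {X e} → e ∈ X → a * length (supersets X L) ≤ b * length (supersets (X - e) L)) →
  ∀ X → a ^ ∣ X ∣ * length (supersets X L) ≤ b ^ ∣ X ∣ * length L
supersets-spread {m} a b L removal X = go ∣ X ∣ X refl
  where
  c : Subset m → ℕ
  c Y = length (supersets Y L)
  go : ∀ s Y → ∣ Y ∣ ≡ s → a ^ s * c Y ≤ b ^ s * length L
  go zero    Y _ = subst₂ _≤_ (sym (*-identityˡ (c Y))) (sym (*-identityˡ (length L)))
                              (length-filter (Y ⊆?_) L)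
  go (suc s) Y ∣Y∣≡1+s with ∣p∣≡1+s⇒∣p-x∣≡s Y ∣Y∣≡1+s
  ... | e , e∈Y , ∣Y-e∣≡s = begin
    a ^ suc s * c Y          ≡⟨ *-assoc a (a ^ s) (c Y) ⟩
    a * (a ^ s * c Y)        ≡⟨ x∙yz≈y∙xz a (a ^ s) (c Y) ⟩
    a ^ s * (a * c Y)        ≤⟨ *-monoʳ-≤ (a ^ s) (removal e∈Y) ⟩
    a ^ s * (b * c (Y - e))  ≡⟨ x∙yz≈y∙xz (a ^ s) b (c (Y - e)) ⟩
    b * (a ^ s * c (Y - e))  ≤⟨ *-monoʳ-≤ b (go s (Y - e) ∣Y-e∣≡s) ⟩
    b * (b ^ s * length L)   ≡⟨ *-assoc b (b ^ s) (length L) ⟨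
    b ^ suc s * length L     ∎
    where open ≤-Reasoning

module Graphs (n : ℕ) where

  Graph : Set
  Graph = Subset (numEdges n)

  private
    variable
      S S′ D : Graph
      e e′ f : Fin (numEdges n)
      p q u v w x y : Fin n

  Joins : Fin (numEdges n) → Fin n → Fin n → Set
  Joins e u v = edge n e ≡ (u , v) ⊎ edge n e ≡ (v , u)

  joins-sym : Joins e u v → Joins e v u
  joins-sym (inj₁ eq) = inj₂ eq
  joins-sym (inj₂ eq) = inj₁ eq

  joins-ends : Joins e u v → Joins e x y → (u ≡ x × v ≡ y) ⊎ (u ≡ y × v ≡ x)
  joins-ends (inj₁ refl) (inj₁ refl) = inj₁ (refl , refl)
  joins-ends (inj₁ refl) (inj₂ refl) = inj₂ (refl , refl)
  joins-ends (inj₂ refl) (inj₁ refl) = inj₂ (refl , refl)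
  joins-ends (inj₂ refl) (inj₂ refl) = inj₁ (refl , refl)

  joins-ordered : edge n e ≡ (u , v) → u Fin.< v
  joins-ordered {e} eq = subst (λ uv → proj₁ uv Fin.< proj₂ uv) eq (edge-ordered n e)

  joins-injective : Joins e u v → Joins e′ u v → e ≡ e′
  joins-injective (inj₁ eq) (inj₁ eq′) = edge-injective n (trans eq (sym eq′))
  joins-injective (inj₁ eq) (inj₂ eq′) = ⊥-elim (<-asym (joins-ordered eq) (joins-ordered eq′))
  joins-injective (inj₂ eq) (inj₁ eq′) = ⊥-elim (<-asym (joins-ordered eq) (joins-ordered eq′))
  joins-injective (inj₂ eq) (inj₂ eq′) = edge-injective n (trans eq (sym eq′))

  joins-irreflexive : ¬ Joins e u u
  joins-irreflexive (inj₁ eq) = <-irrefl refl (joins-ordered eq)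
  joins-irreflexive (inj₂ eq) = <-irrefl refl (joins-ordered eq)

  joins-exists : u ≢ v → ∃ λ e → Joins e u v
  joins-exists {u} {v} u≢v with <-cmp u v
  ... | tri< u<v _ _ = map₂ inj₁ (edge-surjective n u<v)
  ... | tri≈ _ u≡v _ = ⊥-elim (u≢v u≡v)
  ... | tri> _ _ v<u = map₂ inj₂ (edge-surjective n v<u)

  joins? : ∀ e u v → Dec (Joins e u v)
  joins? e u v = ≡-dec _≟_ _≟_ (edge n e) (u , v) ⊎-dec ≡-dec _≟_ _≟_ (edge n e) (v , u)

  adj : e ∈ S → Joins e u v → Adj S u v
  adj e∈S uv = _ , []=⇒lookup e∈S , uv

  adj-sym : Adj S u v → Adj S v u
  adj-sym (e , Se , uv) = e , Se , joins-sym uv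

  adj-mono : S ⊆ S′ → Adj S u v → Adj S′ u v
  adj-mono {S = S} S⊆S′ (e , Se , uv) = adj (S⊆S′ (lookup⇒[]= e S Se)) uv

  adj-avoiding : Adj S u v → ¬ Joins e u v → Adj (S - e) u v
  adj-avoiding {S = S} {e = e} (f , Sf , uv) ¬e-uv with f ≟ e
  ... | yes refl = ⊥-elim (¬e-uv uv)
  ... | no f≢e   = adj (x∈p∧x≢y⇒x∈p-y (lookup⇒[]= f S Sf) f≢e) uv

  adj? : ∀ S u v → Dec (Adj S u v)
  adj? S u v = any? λ e → (lookup S e Bool.≟ true) ×-dec joins? e u v

  infixr 5 _◅◅_

  _◅◅_ : Reach S u v → Reach S v w → Reach S u w
  here     ◅◅ r′ = r′
  step a r ◅◅ r′ = step a (r ◅◅ r′)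

  reach-edge : e ∈ S → Joins e u v → Reach S u v
  reach-edge e∈S uv = step (adj e∈S uv) here

  reach-sym : Reach S u v → Reach S v u
  reach-sym here       = here
  reach-sym {S = S} (step a r) = reach-sym r ◅◅ step (adj-sym {S = S} a) here

  reach-mono : S ⊆ S′ → Reach S u v → Reach S′ u v
  reach-mono S⊆S′ here                  = here
  reach-mono {S = S} S⊆S′ (step a r) = step (adj-mono {S = S} S⊆S′ a) (reach-mono S⊆S′ r)

  -- Reachability in D extended by the edge xy.
  ReachAcross : Graph → Fin n → Fin n → Fin n → Fin n → Set
  ReachAcross D x y u w = Reach D u w ⊎ (Reach D u x × Reach D y w) ⊎ (Reach D u y × Reach D x w)

  across-swap : ReachAcross D x y u w → ReachAcross D y x u w
  across-swap (inj₁ uw)              = inj₁ uw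
  across-swap (inj₂ (inj₁ ux×yw))    = inj₂ (inj₂ ux×yw)
  across-swap (inj₂ (inj₂ uy×xw))    = inj₂ (inj₁ uy×xw)

  across-step : Adj D u v → ReachAcross D x y v w → ReachAcross D x y u w
  across-step a (inj₁ vw)               = inj₁ (step a vw)
  across-step a (inj₂ (inj₁ (vx , yw))) = inj₂ (inj₁ (step a vx , yw))
  across-step a (inj₂ (inj₂ (vy , xw))) = inj₂ (inj₂ (step a vy , xw))

  across-cross : ReachAcross D x y y w → ReachAcross D x y x w
  across-cross (inj₁ yw)              = inj₂ (inj₁ (here , yw))
  across-cross (inj₂ (inj₁ (_ , yw))) = inj₂ (inj₁ (here , yw))
  across-cross (inj₂ (inj₂ (_ , xw))) = inj₁ xw

  reach-split : Joins e x y → Reach S u w → ReachAcross (S - e) x y u w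
  reach-split xy here = inj₁ here
  reach-split {e = e} {S = S} xy (step (f , Sf , uv) r) with f ≟ e | reach-split xy r
  ... | no f≢e   | across = across-step (adj (x∈p∧x≢y⇒x∈p-y (lookup⇒[]= f S Sf) f≢e) uv) across
  ... | yes refl | across with joins-ends uv xy
  ...   | inj₁ (refl , refl) = across-cross across
  ...   | inj₂ (refl , refl) = across-swap (across-cross (across-swap across))

  IsBridge : Graph → Fin (numEdges n) → Set
  IsBridge S e = ∀ {u v} → Joins e u v → ¬ Reach (S - e) u v

  Acyclic : Graph → Set
  Acyclic S = ∀ {e} → e ∈ S → IsBridge S e

  Tree : Graph → Set
  Tree S = Connected {n} S × Acyclic S

  vertices : Reach S u w → List (Fin n)
  vertices {u = u} here       = u ∷ []
  vertices {u = u} (step _ r) = u ∷ vertices r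

  suffix-from : (r : Reach S u w) → x List.∈ vertices r →
    Σ (Reach S x w) λ r′ → ∃ λ prefix → vertices r ≡ prefix ++ vertices r′
  suffix-from here       (here refl) = here , [] , refl
  suffix-from (step a r) (here refl) = step a r , [] , refl
  suffix-from {u = u} (step a r) (there x∈r) with suffix-from r x∈r
  ... | r′ , prefix , eq = r′ , u ∷ prefix , cong (u ∷_) eq

  shortcut : Reach S u w → Σ (Reach S u w) λ r → Unique (vertices r)
  shortcut here = here , [] ∷ []
  shortcut {u = u} (step a r) with shortcut r
  ... | r′ , r′! with Any.any? (u ≟_) (vertices r′)
  ... | no  u∉r′ = step a r′ , ¬Any⇒All¬ _ u∉r′ ∷ r′!
  ... | yes u∈r′ with suffix-from r′ u∈r′
  ...   | r″ , prefix , eq = r″ , drop-prefix prefix (subst Unique eq r′!)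
    where
    drop-prefix : ∀ prefix {xs : List (Fin n)} → Unique (prefix ++ xs) → Unique xs
    drop-prefix []           xs! = xs!
    drop-prefix (_ ∷ prefix) (_ ∷ xs!) = drop-prefix prefix xs!

  reach-within? : ∀ S k u w → Dec (Σ (Reach S u w) λ r → length (vertices r) ≤ suc k)
  reach-within? S k u w with u ≟ w
  ... | yes refl = yes (here , s≤s z≤n)
  reach-within? S zero u w | no u≢w = no λ where
    (here , _)                   → u≢w refl
    (step _ here , s≤s ())
    (step _ (step _ _) , s≤s ())
  reach-within? S (suc k) u w | no u≢w with any? (λ v → adj? S u v ×-dec reach-within? S k v w)
  ... | yes (_ , a , r , r≤) = yes (step a r , s≤s r≤)
  ... | no ∄v = no λ where
    (here , _)           → u≢w refl
    (step a r , s≤s r≤)  → ∄v (_ , a , r , r≤)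

  reach? : ∀ S u w → Dec (Reach S u w)
  reach? S u w with reach-within? S n u w
  ... | yes (r , _) = yes r
  ... | no ∄r = no λ r → let (r′ , r′!) = shortcut r in
    ∄r (r′ , ≤-trans (unique⇒length≤ r′!) (n≤1+n n))

  vertices-nonempty : (r : Reach S u w) → 1 ≤ length (vertices r)
  vertices-nonempty here       = s≤s z≤n
  vertices-nonempty (step _ _) = s≤s z≤n

  isWalk-closed : S′ ⊆ S → (r : Reach S′ u w) → Adj S w x → IsWalk {n} S (vertices r ++ [ x ])
  isWalk-closed S′⊆S here wx = wx , _
  isWalk-closed {S′ = S′} S′⊆S (step a here) wx = adj-mono {S = S′} S′⊆S a , wx , _
  isWalk-closed {S′ = S′} S′⊆S (step a (step b r)) wx =
    adj-mono {S = S′} S′⊆S a , isWalk-closed S′⊆S (step b r) wx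

  spanningTree⇒tree : IsSpanningTree {n} S → Tree S
  spanningTree⇒tree {S} (connected , no-cycle) = connected , bridge
    where
    bridge : Acyclic S
    bridge {e} e∈S {u} {v} uv r with shortcut r
    ... | here , _ = joins-irreflexive uv
    ... | step (f , Sf , uv′) here , _ = x∈p-y⇒x≢y (lookup⇒[]= f (S - e) Sf) (joins-injective uv′ uv)
    ... | step a (step b r′) , r! =
      no-cycle (u , vertices (step b r′) , s≤s (vertices-nonempty r′) , r! ,
                isWalk-closed p-x⊆p (step a (step b r′)) (adj e∈S (joins-sym uv)))

  acyclic⇒¬cycle : Acyclic S → ¬ HasCycle {n} S
  acyclic⇒¬cycle acyclic (_ , [] , () , _)
  acyclic⇒¬cycle acyclic (_ , _ ∷ [] , s≤s () , _)
  acyclic⇒¬cycle {S} acyclic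
    (v₀ , v₁ ∷ v₂ ∷ vs , _ , (v₀∉ ∷ v₁∉ ∷ _) , ((e , Se , v₀v₁) , v₁v₂ , v₂⋯v₀)) =
    acyclic (lookup⇒[]= e S Se) v₀v₁ (reach-sym (step v₁v₂′ (avoid v₂ vs off v₂⋯v₀)))
    where
    Off : Fin n → Set
    Off z = v₀ ≢ z × v₁ ≢ z
    off : All.All Off (v₂ ∷ vs)
    off = All.zip (All.tail v₀∉ , v₁∉)
    lift : ∀ {a b} → Off a → Adj S a b → Adj (S - e) a b
    lift (v₀≢a , v₁≢a) ab = adj-avoiding {S = S} ab λ e-ab → case joins-ends e-ab v₀v₁ of λ where
      (inj₁ (a≡v₀ , _)) → v₀≢a (sym a≡v₀)
      (inj₂ (a≡v₁ , _)) → v₁≢a (sym a≡v₁)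
    v₁v₂′ : Adj (S - e) v₁ v₂
    v₁v₂′ = adj-sym {S = S - e} (lift (All.head off) (adj-sym {S = S} v₁v₂))
    avoid : ∀ a zs → All.All Off (a ∷ zs) → IsWalk {n} S (a ∷ zs ++ [ v₀ ]) → Reach (S - e) a v₀
    avoid a []       (a-off ∷ _)      (av₀ , _)    = step (lift a-off av₀) here
    avoid a (z ∷ zs) (a-off ∷ zs-off) (az , walk) = step (lift a-off az) (avoid z zs zs-off walk)

  tree⇒spanningTree : Tree S → IsSpanningTree {n} S
  tree⇒spanningTree (connected , acyclic) = connected , acyclic⇒¬cycle acyclic

  connected⇒sides : Connected {n} S → Joins e p q → ∀ v → Reach (S - e) p v ⊎ Reach (S - e) q v
  connected⇒sides connected pq v with reach-split pq (connected _ v)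
  ... | inj₁ pv               = inj₁ pv
  ... | inj₂ (inj₁ (_ , qv))  = inj₂ qv
  ... | inj₂ (inj₂ (_ , pv))  = inj₁ pv

  bridge-side-≢ : IsBridge S e → Joins e p q → Reach (S - e) q v → p ≢ v
  bridge-side-≢ bridge pq qv refl = bridge pq (reach-sym qv)

  module Exchange {A : Graph} {e e′ : Fin (numEdges n)} {p q v : Fin n}
                  (tree : Tree A) (e∈A : e ∈ A) (pq : Joins e p q)
                  (qv : Reach (A - e) q v) (pv : Joins e′ p v) where

    A′ : Graph
    A′ = exchange A e e′

    private
      p≁q : ¬ Reach (A - e) p q
      p≁q = proj₂ tree e∈A pq

      lift : Reach (A - e) x y → Reach A′ x y
      lift = reach-mono (p⊆p∪q ⁅ e′ ⁆)

      p→v : Reach A′ p v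
      p→v = reach-edge (y∈exchange e′) pv

      A′-e′⊆A-e : A′ - e′ ⊆ A - e
      A′-e′⊆A-e x∈ = ∈-exchange⁻ (p-x⊆p x∈) (x∈p-y⇒x≢y x∈)

      A′-f-e′⊆A-e-f : (A′ - f) - e′ ⊆ (A - e) - f
      A′-f-e′⊆A-e-f x∈ =
        x∈p∧x≢y⇒x∈p-y (A′-e′⊆A-e (p⊆q⇒p-x⊆q-x p-x⊆p x∈)) (x∈p-y⇒x≢y (p-x⊆p x∈))

      -- If the path q ⋯ v avoids f, then s ⋯ p –e– q ⋯ v ⋯ t joins the ends of f in A − f;
      -- if it crosses f, then p and q are already joined in A − e.
      no-detour : ∀ {s t} → f ∈ A - e → Joins f s t →
        Reach ((A - e) - f) s p → Reach ((A - e) - f) v t → ⊥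
      no-detour {f} f∈A-e st sp vt with reach-split st qv
      ... | inj₁ qv′ =
        proj₂ tree (p-x⊆p f∈A-e) st (down sp ◅◅ reach-edge e∈A-f pq ◅◅ down qv′ ◅◅ down vt)
        where
        e∈A-f : e ∈ A - f
        e∈A-f = x∈p∧x≢y⇒x∈p-y e∈A (≢-sym (x∈p-y⇒x≢y f∈A-e))
        down : Reach ((A - e) - f) x y → Reach (A - f) x y
        down = reach-mono (p⊆q⇒p-x⊆q-x p-x⊆p)
      ... | inj₂ (inj₁ (qs , _)) = p≁q (reach-mono p-x⊆p (reach-sym sp ◅◅ reach-sym qs))
      ... | inj₂ (inj₂ (_ , sv)) = p≁q (reach-mono p-x⊆p (reach-sym sp ◅◅ sv) ◅◅ reach-sym qv)

    fresh : e′ ∈ A → e′ ≡ e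
    fresh e′∈A with e′ ≟ e
    ... | yes e′≡e = e′≡e
    ... | no  e′≢e =
      ⊥-elim (p≁q (reach-edge (x∈p∧x≢y⇒x∈p-y e′∈A e′≢e) pv ◅◅ reach-sym qv))

    connected : Connected {n} A′
    connected x y with reach-split pq (proj₁ tree x y)
    ... | inj₁ xy               = lift xy
    ... | inj₂ (inj₁ (xp , qy)) = lift xp ◅◅ p→v ◅◅ lift (reach-sym qv ◅◅ qy)
    ... | inj₂ (inj₂ (xq , py)) = lift (xq ◅◅ qv) ◅◅ reach-sym p→v ◅◅ lift py

    acyclic : Acyclic A′
    acyclic {f} f∈A′ st r with f ≟ e′
    ... | yes refl = case joins-ends st pv of λ where
      (inj₁ (refl , refl)) → p≁q (reach-mono A′-e′⊆A-e r ◅◅ reach-sym qv)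
      (inj₂ (refl , refl)) → p≁q (reach-mono A′-e′⊆A-e (reach-sym r) ◅◅ reach-sym qv)
    ... | no f≢e′ with reach-split pv r
    ...   | inj₁ st′ = proj₂ tree (p-x⊆p (∈-exchange⁻ f∈A′ f≢e′)) st
                         (reach-mono (p⊆q⇒p-x⊆q-x p-x⊆p) (reach-mono A′-f-e′⊆A-e-f st′))
    ...   | inj₂ (inj₁ (sp , vt)) = no-detour (∈-exchange⁻ f∈A′ f≢e′) st
                                      (reach-mono A′-f-e′⊆A-e-f sp) (reach-mono A′-f-e′⊆A-e-f vt)
    ...   | inj₂ (inj₂ (sv , pt)) = no-detour (∈-exchange⁻ f∈A′ f≢e′) (joins-sym st)
                                      (reach-mono A′-f-e′⊆A-e-f (reach-sym pt))
                                      (reach-mono A′-f-e′⊆A-e-f (reach-sym sv))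

    exchange-tree : Tree A′
    exchange-tree = connected , acyclic

  exchange-injective : ∀ {A₁ A₂ e e₁ e₂ p q v₁ v₂} →
    IsBridge A₁ e → IsBridge A₂ e → Joins e p q →
    Reach (A₁ - e) q v₁ → Joins e₁ p v₁ → Joins e₂ p v₂ →
    exchange A₁ e e₁ ≡ exchange A₂ e e₂ → v₁ ≡ v₂
  exchange-injective {A₁} {A₂} {e} {e₁} {e₂} {p} {q} {v₁} {v₂} bridge₁ bridge₂ pq qv₁ pv₁ pv₂ same
    with v₁ ≟ v₂
  ... | yes v₁≡v₂ = v₁≡v₂
  ... | no  v₁≢v₂ = ⊥-elim (crossing (reach-split pv₂ qv₁))
    where
    e₁≢e₂ : e₁ ≢ e₂
    e₁≢e₂ refl with joins-ends pv₁ pv₂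
    ... | inj₁ (_ , v₁≡v₂)    = v₁≢v₂ v₁≡v₂
    ... | inj₂ (_ , v₁≡p)     = bridge-side-≢ bridge₁ pq qv₁ (sym v₁≡p)
    e₁∈A₂-e : e₁ ∈ A₂ - e
    e₁∈A₂-e = ∈-exchange⁻ (subst (e₁ ∈_) same (y∈exchange e₁)) e₁≢e₂
    A₁-e-e₂⊆A₂-e : (A₁ - e) - e₂ ⊆ A₂ - e
    A₁-e-e₂⊆A₂-e x∈ =
      ∈-exchange⁻ (subst (_ ∈_) same (p⊆p∪q ⁅ e₁ ⁆ (p-x⊆p x∈))) (x∈p-y⇒x≢y x∈)
    crossing : ReachAcross ((A₁ - e) - e₂) p v₂ q v₁ → ⊥
    crossing (inj₁ qv₁′) =
      bridge₂ pq (reach-sym (reach-mono A₁-e-e₂⊆A₂-e qv₁′ ◅◅ reach-edge e₁∈A₂-e (joins-sym pv₁)))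
    crossing (inj₂ (inj₁ (qp , _))) =
      bridge₁ pq (reach-sym (reach-mono p-x⊆p qp))
    crossing (inj₂ (inj₂ (_ , pv₁′))) =
      bridge₁ pq (reach-mono p-x⊆p pv₁′ ◅◅ reach-sym qv₁)

module RemovalStep (n : ℕ) (T : Subset (numEdges n)) {L : List (Subset (numEdges n))} (L! : Unique L)
                   (members : ∀ B → (B List.∈ L) ⇔ restrict (SpanningTrees n) T B)
                   {X : Subset (numEdges n)} {e : Fin (numEdges n)} (e∈X : e ∈ X) where
  open Graphs n

  P Q : List Graph
  P = supersets X L
  Q = supersets (X - e) L

  p q : Fin n
  p = proj₁ (edge n e)
  q = proj₂ (edge n e)

  pq : Joins e p q
  pq = inj₁ refl

  -- The edge uv of Kₙ; the value e for u ≡ v is junk and never used.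
  joining : Fin n → Fin n → Fin (numEdges n)
  joining u v with u ≟ v
  ... | yes _   = e
  ... | no  u≢v = proj₁ (joins-exists u≢v)

  joining-joins : ∀ {u v} → u ≢ v → Joins (joining u v) u v
  joining-joins {u} {v} u≢v with u ≟ v
  ... | yes u≡v  = ⊥-elim (u≢v u≡v)
  ... | no  u≢v′ = proj₂ (joins-exists u≢v′)

  exchanged : Fin n → Graph → Fin n → Graph
  exchanged u B v = exchange (B ∪ T) e (joining u v) ─ T

  module Member {B : Graph} (B∈P : B List.∈ P) where

    B∈L : B List.∈ L
    B∈L = proj₁ (∈-filter⁻ (X ⊆?_) {xs = L} B∈P)

    X⊆B : X ⊆ B
    X⊆B = proj₂ (∈-filter⁻ (X ⊆?_) {xs = L} B∈P)

    tree : Tree (B ∪ T)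
    tree = spanningTree⇒tree (proj₁ (restrict⇒∪ (Equivalence.to (members B) B∈L)))

    B#T : Disjoint B T
    B#T = proj₂ (restrict⇒∪ (Equivalence.to (members B) B∈L))

    e∈B∪T : e ∈ B ∪ T
    e∈B∪T = p⊆p∪q T (X⊆B e∈X)

    bridge : IsBridge (B ∪ T) e
    bridge = proj₂ tree e∈B∪T

    T⊆exchange : ∀ {e′} → T ⊆ exchange (B ∪ T) e e′
    T⊆exchange x∈T = ∈-exchange⁺ (q⊆p∪q B T x∈T) λ { refl → B#T (X⊆B e∈X) x∈T }

    exchanged∪T : ∀ u v → exchanged u B v ∪ T ≡ exchange (B ∪ T) e (joining u v)
    exchanged∪T _ _ = p─q∪q≡p T⊆exchange

  module Side {u w : Fin n} (uw : Joins e u w) where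

    module _ {B : Graph} {v : Fin n} (B∈P : B List.∈ P) (wv : Reach ((B ∪ T) - e) w v) where
      open Member B∈P

      uv : Joins (joining u v) u v
      uv = joining-joins (bridge-side-≢ bridge uw wv)

      exchanged∈Q : exchanged u B v List.∈ Q
      exchanged∈Q = ∈-filter⁺ (X - e ⊆?_) (Equivalence.from (members _) member) X-e⊆
        where
        member : restrict (SpanningTrees n) T (exchanged u B v)
        member =
          _ , tree⇒spanningTree (Exchange.exchange-tree tree e∈B∪T uw wv uv) , T⊆exchange , refl
        X-e⊆ : X - e ⊆ exchanged u B v
        X-e⊆ x∈ = x∈p∧x∉q⇒x∈p─q (∈-exchange⁺ (p⊆p∪q T x∈B) (x∈p-y⇒x≢y x∈)) (B#T x∈B)
          where x∈B = X⊆B (p-x⊆p x∈)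

      exchange-back : exchange (exchange (B ∪ T) e (joining u v)) (joining u v) e ─ T ≡ B
      exchange-back = trans (cong (_─ T) (exchange-cancel e∈B∪T (Exchange.fresh tree e∈B∪T uw wv uv)))
                            (p∪q─q≡p B#T)

    exchanged-injective : ∀ {B₁ B₂ v₁ v₂} (B₁∈P : B₁ List.∈ P) (B₂∈P : B₂ List.∈ P) →
      Reach ((B₁ ∪ T) - e) w v₁ → Reach ((B₂ ∪ T) - e) w v₂ →
      exchanged u B₁ v₁ ≡ exchanged u B₂ v₂ → B₁ ≡ B₂ × v₁ ≡ v₂
    exchanged-injective {v₁ = v₁} {v₂} B₁∈P B₂∈P wv₁ wv₂ eq
      with same ← trans (sym (Member.exchanged∪T B₁∈P u v₁))
                        (trans (cong (_∪ T) eq) (Member.exchanged∪T B₂∈P u v₂))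
      with refl ← exchange-injective (Member.bridge B₁∈P) (Member.bridge B₂∈P) uw wv₁
                                     (uv B₁∈P wv₁) (uv B₂∈P wv₂) same
      = trans (sym (exchange-back B₁∈P wv₁))
              (trans (cong (λ A → exchange A (joining u v₁) e ─ T) same) (exchange-back B₂∈P wv₂))
      , refl

  classify : (B : Graph) (v : Fin n) → Dec (Reach ((B ∪ T) - e) q v) → Graph × Bool
  classify B v (yes _) = exchanged p B v , true
  classify B v (no _)  = exchanged q B v , false

  image : Graph × Fin n → Graph × Bool
  image (B , v) = classify B v (reach? ((B ∪ T) - e) q v)

  Domain : List (Graph × Fin n)
  Domain = cartesianProduct P (allFin n)

  Codomain : List (Graph × Bool)
  Codomain = cartesianProduct Q (true ∷ false ∷ [])

  far-side : ∀ {B v} → B List.∈ P → ¬ Reach ((B ∪ T) - e) q v → Reach ((B ∪ T) - e) p v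
  far-side {v = v} B∈P ¬qv with connected⇒sides (proj₁ (Member.tree B∈P)) pq v
  ... | inj₁ pv = pv
  ... | inj₂ qv = ⊥-elim (¬qv qv)

  classify∈ : ∀ {B v} → B List.∈ P → (d : Dec (Reach ((B ∪ T) - e) q v)) →
    classify B v d List.∈ Codomain
  classify∈ B∈P (yes qv) = ∈-cartesianProduct⁺ (Side.exchanged∈Q pq B∈P qv) (here refl)
  classify∈ B∈P (no ¬qv) =
    ∈-cartesianProduct⁺ (Side.exchanged∈Q (joins-sym pq) B∈P (far-side B∈P ¬qv)) (there (here refl))

  classify-injective : ∀ {B₁ B₂ v₁ v₂} → B₁ List.∈ P → B₂ List.∈ P → ∀ d₁ d₂ →
    classify B₁ v₁ d₁ ≡ classify B₂ v₂ d₂ → (B₁ , v₁) ≡ (B₂ , v₂)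
  classify-injective B₁∈P B₂∈P (yes qv₁) (yes qv₂) eq
    with Side.exchanged-injective pq B₁∈P B₂∈P qv₁ qv₂ (cong proj₁ eq)
  ... | refl , refl = refl
  classify-injective B₁∈P B₂∈P (no ¬qv₁) (no ¬qv₂) eq
    with Side.exchanged-injective (joins-sym pq) B₁∈P B₂∈P (far-side B₁∈P ¬qv₁) (far-side B₂∈P ¬qv₂)
                                  (cong proj₁ eq)
  ... | refl , refl = refl
  classify-injective _ _ (yes _) (no _) ()
  classify-injective _ _ (no _) (yes _) ()

  removal-step : n * length P ≤ 2 * length Q
  removal-step = subst₂ _≤_ |Domain| |Codomain|
    (length-≤-injection image (Unique.cartesianProduct⁺ (Unique.filter⁺ (X ⊆?_) L!) (Unique.allFin⁺ n))
      (λ B,v∈ → classify∈ (proj₁ (∈-cartesianProduct⁻ P (allFin n) B,v∈)) _)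
      (λ B,v₁∈ B,v₂∈ → classify-injective (proj₁ (∈-cartesianProduct⁻ P (allFin n) B,v₁∈))
                                          (proj₁ (∈-cartesianProduct⁻ P (allFin n) B,v₂∈)) _ _))
    where
    |Domain| : length Domain ≡ n * length P
    |Domain| = trans (length-cartesianProduct P (allFin n))
                     (trans (cong (length P *_) (length-tabulate {n = n} (λ i → i))) (*-comm (length P) n))
    |Codomain| : length Codomain ≡ 2 * length Q
    |Codomain| = trans (length-cartesianProduct Q (true ∷ false ∷ [])) (*-comm (length Q) 2)

lemma4p3 : (n : ℕ) → 2 < n → SpreadRT n 2 (n ∸ 1) (SpanningTrees n)
lemma4p3 n _ T _ X _ _ (K , refl , K! , K-members) (L , refl , L! , L-members) = begin
  n ^ ∣ X ∣ * length K                ≤⟨ *-monoʳ-≤ (n ^ ∣ X ∣) restriction≤supersets ⟩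
  n ^ ∣ X ∣ * length (supersets X L)  ≤⟨ supersets-spread n 2 L removal X ⟩
  2 ^ ∣ X ∣ * length L                ∎
  where
  open ≤-Reasoning
  restriction≤supersets : length K ≤ length (supersets X L)
  restriction≤supersets =
    ∣restrict∣≤∣supersets∣ K! (Equivalence.to (K-members _)) (Equivalence.from (L-members _))
  removal : ∀ {Y e} → e ∈ Y → n * length (supersets Y L) ≤ 2 * length (supersets (Y - e) L)
  removal = RemovalStep.removal-step n T L! L-members
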